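{- Let $(M,\leq,\sqsubseteq)$ be a mixed lattice satisfying one (equivalently, all) of the conditions (a)–(j) listed in the context. Then the pre-regularity condition holds: $x\sqsubseteq y$ implies $x\leq y$ for all $x,y\in M$; and consequently, for all $x,y\in M$, $x\leq y \iff y\sqcup x=y \iff x\sqcap y=x$.
   Context: Let $M$ be a set with two partial orderings $\leq$ and $\sqsubseteq$. For $x,y\in M$ the mixed upper envelope is $x\sqcup y=\min\{w\in M: x\sqsubseteq w \text{ and } y\leq w\}$ and the mixed lower envelope is $x\sqcap y=\max\{w\in M: w\sqsubseteq x\text{ and } w\leq y\}$, where the minimum and maximum are taken with respect to $\leq$. The triple $(M,\leq,\sqsubseteq)$ is called a mixed lattice if $x\sqcup y$ and $x\sqcap y$ exist in $M$ for all $x,y\in M$. The conditions (which are equivalent in any mixed lattice) are: (a) for all $x,y,z$: $x\sqsubseteq z$ and $y\sqsubseteq z$ imply $x\sqcup y\sqsubseteq z$; (b) for all $x,y,z$: $x\sqsubseteq y$ implies $z\sqcap x\sqsubseteq z\sqcap y$; (c) $(z\sqcap x)\sqcup(z\sqcap y)\leq z\sqcap(x\sqcup y)$ for all $x,y,z$; (d) $x\sqcap(y\sqcap z)\leq (x\sqcap y)\sqcap z$ for all $x,y,z$; (e) for all $x,y,z$: $z\sqsubseteq x$ and $z\sqsubseteq y$ imply $z\sqsubseteq x\sqcap y$; (f) for all $x,y,z$: $x\sqsubseteq y$ implies $z\sqcup x\sqsubseteq z\sqcup y$; (g) $z\sqcup(x\sqcap y)\leq (z\sqcup x)\sqcap(z\sqcup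 y)$ for all $x,y,z$; (h) $(x\sqcup y)\sqcup z\leq x\sqcup(y\sqcup z)$ for all $x,y,z$; (i) $(z\sqcap x)\sqcup(z\sqcap y)\leq z\sqcap((z\sqcap x)\sqcup y)$ for all $x,y,z$; (j) for all $x,y,z$: $x\sqsubseteq z$ implies $x\sqcup(z\sqcap y)\leq z\sqcap(x\sqcup y)$. -}

module Defs where

open import Level using (Level; _⊔_; suc)
open import Relation.Binary.PropositionalEquality using (_≡_)
open import Relation.Binary.Structures using (IsPartialOrder)
open import Data.Product using (_×_)
open import Data.Sum using (_⊎_)

-- A mixed lattice (M, ≤, ⊑): two partial orders (w.r.t. propositional
-- equality) and the mixed envelopes, given as operations together with the
-- properties saying they are the ≤-minimum / ≤-maximum of the respective sets.
--   x ⊔ y = min≤ { w | x ⊑ w and y ≤ w }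
--   x ⊓ y = max≤ { w | w ⊑ x and w ≤ y }
record MixedLattice (c ℓ₁ ℓ₂ : Level) : Set (suc (c ⊔ ℓ₁ ⊔ ℓ₂)) where
  infix 4 _≤_ _⊑_
  infixl 6 _⊔ₘ_
  infixl 7 _⊓ₘ_
  field
    Carrier : Set c
    _≤_ : Carrier → Carrier → Set ℓ₁
    _⊑_ : Carrier → Carrier → Set ℓ₂
    ≤-isPartialOrder : IsPartialOrder _≡_ _≤_
    ⊑-isPartialOrder : IsPartialOrder _≡_ _⊑_
    _⊔ₘ_ : Carrier → Carrier → Carrier
    _⊓ₘ_ : Carrier → Carrier → Carrier
    ⊔-upperˡ : ∀ x y → x ⊑ x ⊔ₘ y
    ⊔-upperʳ : ∀ x y → y ≤ x ⊔ₘ y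
    ⊔-least : ∀ x y w → x ⊑ w → y ≤ w → x ⊔ₘ y ≤ w
    ⊓-lowerˡ : ∀ x y → x ⊓ₘ y ⊑ x
    ⊓-lowerʳ : ∀ x y → x ⊓ₘ y ≤ y
    ⊓-greatest : ∀ x y w → w ⊑ x → w ≤ y → w ≤ x ⊓ₘ y

module _ {c ℓ₁ ℓ₂ : Level} (L : MixedLattice c ℓ₁ ℓ₂) where
  open MixedLattice L

  CondA CondB CondE CondF : Set (c ⊔ ℓ₂)
  CondC CondD CondG CondH CondI : Set (c ⊔ ℓ₁)
  CondJ : Set (c ⊔ ℓ₁ ⊔ ℓ₂)
  CondA = ∀ x y z → x ⊑ z → y ⊑ z → x ⊔ₘ y ⊑ z
  CondB = ∀ x y z → x ⊑ y → z ⊓ₘ x ⊑ z ⊓ₘ y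
  CondC = ∀ x y z → (z ⊓ₘ x) ⊔ₘ (z ⊓ₘ y) ≤ z ⊓ₘ (x ⊔ₘ y)
  CondD = ∀ x y z → x ⊓ₘ (y ⊓ₘ z) ≤ (x ⊓ₘ y) ⊓ₘ z
  CondE = ∀ x y z → z ⊑ x → z ⊑ y → z ⊑ x ⊓ₘ y
  CondF = ∀ x y z → x ⊑ y → z ⊔ₘ x ⊑ z ⊔ₘ y
  CondG = ∀ x y z → z ⊔ₘ (x ⊓ₘ y) ≤ (z ⊔ₘ x) ⊓ₘ (z ⊔ₘ y)
  CondH = ∀ x y z → (x ⊔ₘ y) ⊔ₘ z ≤ x ⊔ₘ (y ⊔ₘ z)
  CondI = ∀ x y z → (z ⊓ₘ x) ⊔ₘ (z ⊓ₘ y) ≤ z ⊓ₘ ((z ⊓ₘ x) ⊔ₘ y)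
  CondJ = ∀ x y z → x ⊑ z → x ⊔ₘ (z ⊓ₘ y) ≤ z ⊓ₘ (x ⊔ₘ y)

  SomeCondition : Set (c ⊔ ℓ₁ ⊔ ℓ₂)
  SomeCondition = CondA ⊎ CondB ⊎ CondC ⊎ CondD ⊎ CondE
                ⊎ CondF ⊎ CondG ⊎ CondH ⊎ CondI ⊎ CondJ

  PreRegular : Set (c ⊔ ℓ₁ ⊔ ℓ₂)
  PreRegular = ∀ x y → x ⊑ y → x ≤ y

-- Each condition, instantiated at a pair x ⊑ y with one variable repeated,
-- collapses (via x ⊔ x = x, x ⊓ x = x and the absorption laws for ⊑) to
-- one of x ⊑ x ⊓ y, y ⊔ x ⊑ y or x ⊔ (x ⊓ y) ≤ x ⊓ y, and each of these
-- forces x ≤ y. Conversely, if x ≤ y then y lies in {w | y ⊑ w, x ≤ w}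
-- and x in {w | w ⊑ x, w ≤ y}, so y ⊔ x ≤ y and x ≤ x ⊓ y; pre-regularity
-- turns y ⊑ y ⊔ x and x ⊓ y ⊑ x into the reverse inequalities.
module Submission where

open import Defs
open import Level using (Level)
open import Relation.Binary.PropositionalEquality using (_≡_; subst)
open import Relation.Binary.Structures using (IsPartialOrder)
open import Data.Product using (_×_; _,_)
open import Data.Sum using ([_,_])
open import Function.Bundles using (_⇔_; mk⇔)

module MixedLatticeProperties {c ℓ₁ ℓ₂ : Level} (L : MixedLattice c ℓ₁ ℓ₂) where
  open MixedLattice L
  open IsPartialOrder ≤-isPartialOrder using () renaming (refl to ≤-refl; antisym to ≤-antisym)
  open IsPartialOrder ⊑-isPartialOrder using () renaming (refl to ⊑-refl; antisym to ⊑-antisym)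

  ⊔-≡ʳ : ∀ x y → x ⊔ₘ y ≤ y → x ⊔ₘ y ≡ y
  ⊔-≡ʳ x y p = ≤-antisym p (⊔-upperʳ x y)

  ⊓-≡ʳ : ∀ x y → y ≤ x ⊓ₘ y → x ⊓ₘ y ≡ y
  ⊓-≡ʳ x y p = ≤-antisym (⊓-lowerʳ x y) p

  ⊔-idem : ∀ x → x ⊔ₘ x ≡ x
  ⊔-idem x = ⊔-≡ʳ x x (⊔-least x x x ⊑-refl ≤-refl)

  ⊓-idem : ∀ x → x ⊓ₘ x ≡ x
  ⊓-idem x = ⊓-≡ʳ x x (⊓-greatest x x x ⊑-refl ≤-refl)

  ⊑⇒⊔≡ : ∀ {x y} → x ⊑ y → x ⊔ₘ y ≡ y
  ⊑⇒⊔≡ {x} {y} p = ⊔-≡ʳ x y (⊔-least x y y p ≤-refl)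

  ⊑⇒⊓≡ : ∀ {x y} → x ⊑ y → y ⊓ₘ x ≡ x
  ⊑⇒⊓≡ {x} {y} p = ⊓-≡ʳ y x (⊓-greatest y x x p ≤-refl)

  ⊔≡⇒≤ : ∀ {x y} → y ⊔ₘ x ≡ y → x ≤ y
  ⊔≡⇒≤ {x} {y} e = subst (x ≤_) e (⊔-upperʳ y x)

  ⊓≡⇒≤ : ∀ {x y} → x ⊓ₘ y ≡ x → x ≤ y
  ⊓≡⇒≤ {x} {y} e = subst (_≤ y) e (⊓-lowerʳ x y)

  ⊑⊓⇒≤ : ∀ x y → x ⊑ x ⊓ₘ y → x ≤ y
  ⊑⊓⇒≤ x y p = ⊓≡⇒≤ (⊑-antisym (⊓-lowerˡ x y) p)

  ⊔⊑⇒≤ : ∀ x y → y ⊔ₘ x ⊑ y → x ≤ y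
  ⊔⊑⇒≤ x y p = ⊔≡⇒≤ (⊑-antisym p (⊔-upperˡ y x))

  ⊔⊓≤⊓⇒≤ : ∀ x y → x ⊔ₘ (x ⊓ₘ y) ≤ x ⊓ₘ y → x ≤ y
  ⊔⊓≤⊓⇒≤ x y p = ⊑⊓⇒≤ x y (subst (x ⊑_) (⊔-≡ʳ x (x ⊓ₘ y) p) (⊔-upperˡ x (x ⊓ₘ y)))

  ⊔⊓≤⊓⊔⇒≤ : ∀ {x y} → x ⊑ y → x ⊔ₘ (x ⊓ₘ y) ≤ x ⊓ₘ (x ⊔ₘ y) → x ≤ y
  ⊔⊓≤⊓⊔⇒≤ {x} {y} q p = ⊔⊓≤⊓⇒≤ x y (subst (λ w → x ⊔ₘ (x ⊓ₘ y) ≤ x ⊓ₘ w) (⊑⇒⊔≡ q) p)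

  condA⇒preRegular : CondA L → PreRegular L
  condA⇒preRegular A x y q = ⊔⊑⇒≤ x y (A y x y ⊑-refl q)

  condB⇒preRegular : CondB L → PreRegular L
  condB⇒preRegular B x y q = ⊑⊓⇒≤ x y (subst (_⊑ x ⊓ₘ y) (⊓-idem x) (B x y x q))

  condC⇒preRegular : CondC L → PreRegular L
  condC⇒preRegular C x y q =
    ⊔⊓≤⊓⊔⇒≤ q (subst (λ w → w ⊔ₘ (x ⊓ₘ y) ≤ x ⊓ₘ (x ⊔ₘ y)) (⊓-idem x) (C x y x))

  condD⇒preRegular : CondD L → PreRegular L
  condD⇒preRegular D x y q = ⊑⊓⇒≤ x y (subst (_⊑ x ⊓ₘ y) x⊓y⊓x≡x (⊓-lowerˡ (x ⊓ₘ y) x))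
    where
    x≤x⊓y⊓x : x ≤ x ⊓ₘ y ⊓ₘ x
    x≤x⊓y⊓x = subst (λ w → w ≤ x ⊓ₘ y ⊓ₘ x) (⊓-idem x)
                (subst (λ w → x ⊓ₘ w ≤ x ⊓ₘ y ⊓ₘ x) (⊑⇒⊓≡ q) (D x y x))
    x⊓y⊓x≡x : x ⊓ₘ y ⊓ₘ x ≡ x
    x⊓y⊓x≡x = ⊓-≡ʳ (x ⊓ₘ y) x x≤x⊓y⊓x

  condE⇒preRegular : CondE L → PreRegular L
  condE⇒preRegular E x y q = ⊑⊓⇒≤ x y (E x y x ⊑-refl q)

  condF⇒preRegular : CondF L → PreRegular L
  condF⇒preRegular F x y q = ⊔⊑⇒≤ x y (subst (y ⊔ₘ x ⊑_) (⊔-idem y) (F x y y q))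

  condG⇒preRegular : CondG L → PreRegular L
  condG⇒preRegular G x y q =
    ⊔⊓≤⊓⊔⇒≤ q (subst (λ w → x ⊔ₘ (x ⊓ₘ y) ≤ w ⊓ₘ (x ⊔ₘ y)) (⊔-idem x) (G x y x))

  condH⇒preRegular : CondH L → PreRegular L
  condH⇒preRegular H x y q = ⊔⊑⇒≤ x y (subst (y ⊔ₘ x ⊑_) y⊔x⊔y≡y (⊔-upperˡ (y ⊔ₘ x) y))
    where
    y⊔x⊔y≤y : y ⊔ₘ x ⊔ₘ y ≤ y
    y⊔x⊔y≤y = subst (y ⊔ₘ x ⊔ₘ y ≤_) (⊔-idem y)
                (subst (λ w → y ⊔ₘ x ⊔ₘ y ≤ y ⊔ₘ w) (⊑⇒⊔≡ q) (H y x y))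
    y⊔x⊔y≡y : y ⊔ₘ x ⊔ₘ y ≡ y
    y⊔x⊔y≡y = ⊔-≡ʳ (y ⊔ₘ x) y y⊔x⊔y≤y

  condI⇒preRegular : CondI L → PreRegular L
  condI⇒preRegular I x y q =
    ⊔⊓≤⊓⊔⇒≤ q (subst (λ w → w ⊔ₘ (x ⊓ₘ y) ≤ x ⊓ₘ (w ⊔ₘ y)) (⊓-idem x) (I x y x))

  condJ⇒preRegular : CondJ L → PreRegular L
  condJ⇒preRegular J x y q = ⊔⊓≤⊓⊔⇒≤ q (J x y x ⊑-refl)

  someCondition⇒preRegular : SomeCondition L → PreRegular L
  someCondition⇒preRegular =
    [ condA⇒preRegular , [ condB⇒preRegular , [ condC⇒preRegular
    , [ condD⇒preRegular , [ condE⇒preRegular , [ condF⇒preRegular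
    , [ condG⇒preRegular , [ condH⇒preRegular , [ condI⇒preRegular
    , condJ⇒preRegular ] ] ] ] ] ] ] ] ]

  module _ (preRegular : PreRegular L) where

    ≤⇒⊔≡ : ∀ {x y} → x ≤ y → y ⊔ₘ x ≡ y
    ≤⇒⊔≡ {x} {y} p = ≤-antisym (⊔-least y x y ⊑-refl p) (preRegular y (y ⊔ₘ x) (⊔-upperˡ y x))

    ≤⇒⊓≡ : ∀ {x y} → x ≤ y → x ⊓ₘ y ≡ x
    ≤⇒⊓≡ {x} {y} p = ≤-antisym (preRegular (x ⊓ₘ y) x (⊓-lowerˡ x y)) (⊓-greatest x y x ⊑-refl p)

    ≤⇔⊔≡ : ∀ x y → x ≤ y ⇔ y ⊔ₘ x ≡ y
    ≤⇔⊔≡ x y = mk⇔ ≤⇒⊔≡ ⊔≡⇒≤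

    ⊔≡⇔⊓≡ : ∀ x y → y ⊔ₘ x ≡ y ⇔ x ⊓ₘ y ≡ x
    ⊔≡⇔⊓≡ x y = mk⇔ (λ e → ≤⇒⊓≡ (⊔≡⇒≤ e)) (λ e → ≤⇒⊔≡ (⊓≡⇒≤ e))

theorem2p9 : ∀ {c ℓ₁ ℓ₂ : Level} (L : MixedLattice c ℓ₁ ℓ₂) → SomeCondition L →
    PreRegular L
    × (∀ x y → (MixedLattice._≤_ L x y ⇔ MixedLattice._⊔ₘ_ L y x ≡ y)
             × (MixedLattice._⊔ₘ_ L y x ≡ y ⇔ MixedLattice._⊓ₘ_ L x y ≡ x))
theorem2p9 L condition = preRegular , λ x y → ≤⇔⊔≡ preRegular x y , ⊔≡⇔⊓≡ preRegular x y
  where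
  open MixedLatticeProperties L
  preRegular : PreRegular L
  preRegular = someCondition⇒preRegular condition
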